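{- Let $a$ and $T$ be nonzero integers, and let $x(k)$, $k\in\mathbb{Z}_{\ge0}$, be the integer sequence with $x(0)=0$, $x(1)=x(2)=a$, $x(3)=a(T+1)$, and $x(k+4)=Tx(k+2)-x(k)$ for all $k\ge0$. Then $x(k)$ is a linear divisibility sequence, i.e. for all positive integers $n,m$, $n\mid m$ implies $x(n)\mid x(m)$. -}

module Defs where

open import Data.Nat using (ℕ; zero; suc)
open import Data.Integer using (ℤ; _+_; _*_; _-_; 1ℤ; 0ℤ)

x : ℤ → ℤ → ℕ → ℤ
x a T 0 = 0ℤ
x a T 1 = a
x a T 2 = a
x a T 3 = a * (T + 1ℤ)
x a T (suc (suc (suc (suc k)))) = T * x a T (suc (suc k)) - x a T k

module Submission where

-- Write x(k) = a · u(k), where u is the Lehmer sequence with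
-- parameters R = T + 2 and Q = 1: u(0) = 0, u(1) = 1 and
--   u(j+2) = c(j) · u(j+1) − u(j),   c(j) = 1 for j even, c(j) = R for j odd.
-- Eliminating the odd-indexed middle term shows u(k+4) = (R − 2) u(k+2) − u(k),
-- which is the recurrence of x with T = R − 2; comparing initial values gives
-- x = a · u.  It therefore suffices that u is a divisibility sequence, which
-- follows from the addition formula
--   u(n+p+1) = u(n+1) u(p+1) F(n,p) − u(n) u(p) G(n,p),
-- where F(n,p) = R if n, p are both odd and 1 otherwise, and G(n,p) = R if
-- n, p are both even and 1 otherwise.  Taking p = k·n in the formula shows that
-- u(n) | u((k+1)·n) whenever u(n) | u(k·n), so u(n) | u(k·n) for all k.

open import Defs
open import Data.Nat using (ℕ; _>_)
open import Data.Nat.Divisibility using () renaming (_∣_ to _∣ℕ_)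
open import Data.Integer using (ℤ; 0ℤ)
open import Data.Integer.Divisibility using (_∣_)
open import Relation.Binary.PropositionalEquality using (_≢_)

open import Data.Nat.Base as ℕ using (suc; parity)
open import Data.Nat.Properties using (*-zeroʳ)
open import Data.Nat.Divisibility using (divides)
open import Data.Parity.Base as ℙ using (Parity; 0ℙ; 1ℙ; _⁻¹)
open import Data.Parity.Properties using (⁻¹-selfInverse; suc-homo-⁻¹; +-homo-+)
open import Data.Integer.Base using (_+_; _*_; _-_; +_; 1ℤ)
open import Data.Integer.Properties as ℤ using (*-comm; *-identityˡ; *-identityʳ)
open import Data.Integer.Divisibility.Signed as Signed
  using (∣-refl; ∣⇒∣ᵤ; ∣m∣n⇒∣m-n; ∣m⇒∣m*n; ∣n⇒∣m*n; *-monoʳ-∣)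
open import Data.Integer.Tactic.RingSolver using (solve-∀)
open import Relation.Binary.PropositionalEquality
  using (_≡_; refl; sym; trans; cong; cong₂; subst; subst₂; module ≡-Reasoning)

open ≡-Reasoning

parity-suc : ∀ n → parity (suc n) ≡ parity n ⁻¹
parity-suc n = sym (⁻¹-selfInverse (suc-homo-⁻¹ n))

parity-suc-+ : ∀ n p → parity (suc (n ℕ.+ p)) ≡ (parity n ℙ.+ parity p) ⁻¹
parity-suc-+ n p = begin
  parity (suc (n ℕ.+ p))       ≡⟨ parity-suc (n ℕ.+ p) ⟩
  parity (n ℕ.+ p) ⁻¹          ≡⟨ cong _⁻¹ (+-homo-+ n p) ⟩
  (parity n ℙ.+ parity p) ⁻¹   ∎

module Lehmer (R : ℤ) where

  coeff : Parity → ℤ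
  coeff 0ℙ = 1ℤ
  coeff 1ℙ = R

  u : ℕ → ℤ
  u 0 = 0ℤ
  u 1 = 1ℤ
  u (suc (suc j)) = coeff (parity j) * u (suc j) - u j

  coeff-consecutive : ∀ k → coeff (parity k) * coeff (parity (suc k)) ≡ R
  coeff-consecutive k rewrite parity-suc k with parity k
  ... | 0ℙ = *-identityˡ R
  ... | 1ℙ = *-identityʳ R

  -- Eliminating u(k+3): the even and the odd subsequences each satisfy
  -- the Lucas recurrence with parameter R − 2.
  four-step : ∀ k → u (4 ℕ.+ k) ≡ (R - + 2) * u (2 ℕ.+ k) - u k
  four-step k = begin
    c * (c′ * (c * u₁ - u₀) - u₁) - (c * u₁ - u₀)  ≡⟨ eliminate c c′ u₀ u₁ ⟩
    (c * c′ - + 2) * (c * u₁ - u₀) - u₀              ≡⟨ cong (λ r → (r - + 2) * u (2 ℕ.+ k) - u k)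
                                                          (coeff-consecutive k) ⟩
    (R - + 2) * u (2 ℕ.+ k) - u k                    ∎
    where
    c c′ u₀ u₁ : ℤ
    c = coeff (parity k)
    c′ = coeff (parity (suc k))
    u₀ = u k
    u₁ = u (suc k)
    eliminate : ∀ c c′ u₀ u₁ →
      c * (c′ * (c * u₁ - u₀) - u₁) - (c * u₁ - u₀) ≡ (c * c′ - + 2) * (c * u₁ - u₀) - u₀
    eliminate = solve-∀

  F G : ℕ → ℕ → ℤ
  F n p = coeff (parity n ℙ.* parity p)
  G n p = coeff (parity n ⁻¹ ℙ.* parity p ⁻¹)

  F-shift-parity : ∀ q b → coeff ((q ℙ.+ b) ⁻¹) * coeff (q ⁻¹ ℙ.* b) ≡ coeff (q ⁻¹) * coeff (q ℙ.* b)
  F-shift-parity 0ℙ 0ℙ = refl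
  F-shift-parity 0ℙ 1ℙ = *-comm 1ℤ R
  F-shift-parity 1ℙ 0ℙ = refl
  F-shift-parity 1ℙ 1ℙ = *-comm R 1ℤ

  G-shift-parity : ∀ q b → coeff ((q ℙ.+ b) ⁻¹) * coeff (q ⁻¹ ⁻¹ ℙ.* b ⁻¹) ≡ coeff q * coeff (q ⁻¹ ℙ.* b ⁻¹)
  G-shift-parity 0ℙ 0ℙ = *-comm R 1ℤ
  G-shift-parity 0ℙ 1ℙ = refl
  G-shift-parity 1ℙ 0ℙ = *-comm 1ℤ R
  G-shift-parity 1ℙ 1ℙ = refl

  F-shift : ∀ n p → coeff (parity (suc (n ℕ.+ p))) * F (suc n) p ≡ coeff (parity (suc n)) * F n p
  F-shift n p rewrite parity-suc-+ n p | parity-suc n = F-shift-parity (parity n) (parity p)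

  G-shift : ∀ n p → coeff (parity (suc (n ℕ.+ p))) * G (suc n) p ≡ coeff (parity n) * G n p
  G-shift n p rewrite parity-suc-+ n p | parity-suc n = G-shift-parity (parity n) (parity p)

  -- The ring identity behind the inductive step of the addition formula,
  -- where n₂ stands for c₀ n₁ − n₀ and the weights are related as by the
  -- shift lemmas above.
  addition-step : ∀ c c₀ c₁ F₀ F₁ G₀ G₁ p₀ p₁ n₀ n₁ →
    c * F₁ ≡ c₁ * F₀ → c * G₁ ≡ c₀ * G₀ →
    let n₂ = c₀ * n₁ - n₀ in
    c * (n₂ * p₁ * F₁ - n₁ * p₀ * G₁) - (n₁ * p₁ * F₀ - n₀ * p₀ * G₀)
      ≡ (c₁ * n₂ - n₁) * p₁ * F₀ - n₂ * p₀ * G₀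
  addition-step c c₀ c₁ F₀ F₁ G₀ G₁ p₀ p₁ n₀ n₁ hF hG = begin
    c * (n₂ * p₁ * F₁ - n₁ * p₀ * G₁) - (n₁ * p₁ * F₀ - n₀ * p₀ * G₀)
      ≡⟨ collect c c₀ F₀ F₁ G₀ G₁ p₀ p₁ n₀ n₁ ⟩
    (c * F₁) * n₂ * p₁ - (c * G₁) * n₁ * p₀ - n₁ * p₁ * F₀ + n₀ * p₀ * G₀
      ≡⟨ cong₂ (λ f g → f * n₂ * p₁ - g * n₁ * p₀ - n₁ * p₁ * F₀ + n₀ * p₀ * G₀) hF hG ⟩
    (c₁ * F₀) * n₂ * p₁ - (c₀ * G₀) * n₁ * p₀ - n₁ * p₁ * F₀ + n₀ * p₀ * G₀
      ≡⟨ distribute c₀ c₁ F₀ G₀ p₀ p₁ n₀ n₁ ⟩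
    (c₁ * n₂ - n₁) * p₁ * F₀ - n₂ * p₀ * G₀
      ∎
    where
    n₂ : ℤ
    n₂ = c₀ * n₁ - n₀
    collect : ∀ c c₀ F₀ F₁ G₀ G₁ p₀ p₁ n₀ n₁ → let n₂ = c₀ * n₁ - n₀ in
      c * (n₂ * p₁ * F₁ - n₁ * p₀ * G₁) - (n₁ * p₁ * F₀ - n₀ * p₀ * G₀)
        ≡ (c * F₁) * n₂ * p₁ - (c * G₁) * n₁ * p₀ - n₁ * p₁ * F₀ + n₀ * p₀ * G₀
    collect = solve-∀
    distribute : ∀ c₀ c₁ F₀ G₀ p₀ p₁ n₀ n₁ → let n₂ = c₀ * n₁ - n₀ in
      (c₁ * F₀) * n₂ * p₁ - (c₀ * G₀) * n₁ * p₀ - n₁ * p₁ * F₀ + n₀ * p₀ * G₀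
        ≡ (c₁ * n₂ - n₁) * p₁ * F₀ - n₂ * p₀ * G₀
    distribute = solve-∀

  addition : ∀ n p → u (suc (n ℕ.+ p)) ≡ u (suc n) * u (suc p) * F n p - u n * u p * G n p
  addition 0 p = base₀ (u (suc p)) (u p) (G 0 p)
    where
    base₀ : ∀ v w g → v ≡ 1ℤ * v * 1ℤ - 0ℤ * w * g
    base₀ = solve-∀
  addition 1 p = base₁ (coeff (parity p)) (u (suc p)) (u p)
    where
    base₁ : ∀ c v w → c * v - w ≡ 1ℤ * v * c - 1ℤ * w * 1ℤ
    base₁ = solve-∀
  addition (suc (suc n)) p =
    trans (cong₂ (λ s t → c * s - t) (addition (suc n) p) (addition n p))
          (addition-step c (coeff (parity n)) (coeff (parity (suc n)))
                         (F n p) (F (suc n) p) (G n p) (G (suc n) p)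
                         (u p) (u (suc p)) (u n) (u (suc n))
                         (F-shift n p) (G-shift n p))
    where
    c : ℤ
    c = coeff (parity (suc (n ℕ.+ p)))

  -- u is a divisibility sequence: u(n) divides every u(k·n).  By the addition
  -- formula with p = k·n, u((k+1)·n) is a combination of u(n) and u(k·n).
  u-multiple : ∀ n k → u n Signed.∣ u (k ℕ.* n)
  u-multiple 0 k rewrite *-zeroʳ k = ∣-refl
  u-multiple (suc q) 0 = Signed.divides 0ℤ refl
  u-multiple (suc q) (suc k) =
    subst (u (suc q) Signed.∣_) (sym (addition q (k ℕ.* suc q)))
      (∣m∣n⇒∣m-n (∣m⇒∣m*n (F q (k ℕ.* suc q)) (∣m⇒∣m*n (u (suc (k ℕ.* suc q))) ∣-refl))
                 (∣m⇒∣m*n (G q (k ℕ.* suc q)) (∣n⇒∣m*n (u q) (u-multiple (suc q) k))))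

open Lehmer using (u; four-step; u-multiple)

x≡a*u : ∀ a T k → x a T k ≡ a * u (T + + 2) k
x≡a*u a T 0 = sym (ℤ.*-zeroʳ a)
x≡a*u a T 1 = sym (*-identityʳ a)
x≡a*u a T 2 = sym (*-identityʳ a)
x≡a*u a T 3 = initial a T
  where
  initial : ∀ a T → a * (T + 1ℤ) ≡ a * ((T + + 2) * 1ℤ - 1ℤ)
  initial = solve-∀
x≡a*u a T (suc (suc (suc (suc k)))) = begin
  T * x a T (2 ℕ.+ k) - x a T k
    ≡⟨ cong₂ (λ s t → T * s - t) (x≡a*u a T (suc (suc k))) (x≡a*u a T k) ⟩
  T * (a * u R (2 ℕ.+ k)) - a * u R k
    ≡⟨ factor T a (u R (2 ℕ.+ k)) (u R k) ⟩
  a * ((R - + 2) * u R (2 ℕ.+ k) - u R k)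
    ≡⟨ cong (a *_) (sym (four-step R k)) ⟩
  a * u R (4 ℕ.+ k)
    ∎
  where
  R : ℤ
  R = T + + 2
  factor : ∀ T a v w → T * (a * v) - a * w ≡ a * ((T + + 2 - + 2) * v - w)
  factor = solve-∀

-- The theorem.
proposition4 : (a T : ℤ) → a ≢ 0ℤ → T ≢ 0ℤ → (n m : ℕ) → n > 0 → m > 0 → n ∣ℕ m → x a T n ∣ x a T m
proposition4 a T _ _ n m _ _ (divides k refl) =
  subst₂ _∣_ (sym (x≡a*u a T n)) (sym (x≡a*u a T (k ℕ.* n)))
    (∣⇒∣ᵤ (*-monoʳ-∣ a (u-multiple (T + + 2) n k)))
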